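{- Let $a<b$ be coprime positive integers and let $\pi$ be a noncrossing partition of $[b-1]$ having a valid $a,b$-ranking. Suppose $\pi'$ is a noncrossing partition of $[b-1]$ obtained from $\pi$ by merging two blocks $B_0,B_1$ of $\pi$ into $B_0\cup B_1$, where either (1) $\min(B_1)=\max(B_0)+1$, or (2) $B_0\prec B_1$. Then $\pi'$ has a valid $a,b$-ranking.
   Context: Let $[b-1]=\{1,\dots,b-1\}$. A set partition is noncrossing if there are no $i<j<k<\ell$ with $i\sim k$, $j\sim\ell$, $i\not\sim j$. Rank: for a noncrossing partition $\pi$ of $[b-1]$, order its blocks by $B'\preceq B$ iff $[\min B',\max B']\subseteq[\min B,\max B]$ (and $B'\prec B$ means $B'\preceq B$, $B'\ne B$); the integers $\mathrm{rank}^{\pi}_{a,b}(B)$ are the unique integers with $\sum_{B'\preceq B}\mathrm{rank}^{\pi}_{a,b}(B')=\lceil(\max B-\min B+1)\frac ab\rceil$ for every block $B$. $\pi$ has a valid $a,b$-ranking if $\mathrm{rank}^{\pi}_{a,b}(B)>0$ for every block $B$ and $\sum_{B\in\pi}\mathrm{rank}^{\pi}_{a,b}(B)=a$. -}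

module Defs where

open import Data.Nat using (ℕ; zero; suc; _+_; _*_; _∸_; _≤_; _<_; _⊓_; _⊔_)
open import Data.Nat.Properties using (_≤?_)
open import Data.Nat.DivMod using (_/_)
open import Data.Integer using (ℤ; +_) renaming (_+_ to _+ℤ_)
open import Data.List using (List; []; _∷_; foldr; map; filter; concat; applyUpTo)
open import Data.List.Membership.Propositional using (_∈_)
open import Data.List.Relation.Unary.All using (All)
open import Data.List.Relation.Unary.Linked using (Linked)
open import Data.List.Relation.Binary.Permutation.Propositional using (_↭_)
open import Data.Product using (_×_; ∃-syntax)
open import Relation.Nullary using (¬_; Dec)
open import Relation.Nullary.Decidable using (_×-dec_)
open import Relation.Binary.PropositionalEquality using (_≡_; _≢_)

-- A block is a finite set of positive integers, represented canonically
-- as a strictly increasing nonempty list.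
Block : Set
Block = List ℕ

minB : Block → ℕ
minB []       = 0
minB (x ∷ xs) = foldr _⊓_ x xs

maxB : Block → ℕ
maxB []       = 0
maxB (x ∷ xs) = foldr _⊔_ x xs

-- A set partition of [m] = {1,…,m}, given as a list of blocks:
-- every block is nonempty and strictly increasing, and the blocks
-- together contain each of 1,…,m exactly once.
[_] : ℕ → List ℕ
[ m ] = applyUpTo suc m

IsSetPartition : ℕ → List Block → Set
IsSetPartition m π =
  All (λ B → (B ≢ []) × Linked _<_ B) π × (concat π ↭ [ m ])

SameBlock : List Block → ℕ → ℕ → Set
SameBlock π i j = ∃[ B ] (B ∈ π × i ∈ B × j ∈ B)

IsNoncrossing : List Block → Set
IsNoncrossing π = ∀ i j k l → i < j → j < k → k < l →
  SameBlock π i k → SameBlock π j l → ¬ SameBlock π i j → ⊥'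
  where open import Data.Empty renaming (⊥ to ⊥')

NoncrossingPartition : ℕ → List Block → Set
NoncrossingPartition m π = IsSetPartition m π × IsNoncrossing π

_⪯_ : Block → Block → Set
B' ⪯ B = (minB B ≤ minB B') × (maxB B' ≤ maxB B)

_⪯?_ : (B' B : Block) → Dec (B' ⪯ B)
B' ⪯? B = (minB B ≤? minB B') ×-dec (maxB B' ≤? maxB B)

_≺_ : Block → Block → Set
B' ≺ B = (B' ⪯ B) × (B' ≢ B)

-- ceiling division ⌈n / d⌉ (for d > 0)
ceilDiv : ℕ → ℕ → ℕ
ceilDiv n zero    = 0
ceilDiv n (suc d) = (n + d) / suc d

sumℤ : List ℤ → ℤ
sumℤ = foldr _+ℤ_ (+ 0)

target : ℕ → ℕ → Block → ℤ
target a b B = + ceilDiv ((maxB B ∸ minB B + 1) * a) b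

IsRank : ℕ → ℕ → List Block → (Block → ℤ) → Set
IsRank a b π r =
  All (λ B → sumℤ (map r (filter (λ B' → B' ⪯? B) π)) ≡ target a b B) π

-- π has a valid a,b-ranking: the (unique) rank function is positive on
-- every block and its values sum to a.
HasValidRanking : ℕ → ℕ → List Block → Set
HasValidRanking a b π = ∃[ r ] (IsRank a b π r
  × All (λ B → Data.Integer._>_ (r B) (+ 0)) π
  × sumℤ (map r π) ≡ + a)
  where import Data.Integer

-- Write π = B₀ ∷ B₁ ∷ ρ with ranking r. By noncrossingness, a block of ρ lies above B exactly when
-- it lies above B₀, and exactly when it lies above B₁, so only the rank equation of B itself has to be
-- rebalanced. If B₀ ≺ B₁, then B has the span of B₁ and the rank r B₀ + r B₁ works. If B₀ and
-- B₁ are adjacent, the span of B is the union of theirs and ⌈ℓ₀a/b⌉ + ⌈ℓ₁a/b⌉ = ⌈(ℓ₀+ℓ₁)a/b⌉ + ε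
-- with ε ∈ {0, 1}. For ε = 0 the same rank works; for ε = 1 one unit of rank moves from B to
-- the least block P containing the span of B₀. Such a P exists: otherwise B₀ and B₁ are maximal,
-- and since the spans of the maximal blocks R cover [b − 1] while their targets ⌈ℓ_R a/b⌉ ≥ ℓ_R a/b
-- sum to at most a, one gets (b − 1)a + b ≤ ab, contradicting a < b.
module Submission where

open import Defs
open import Data.Nat as ℕ using (ℕ; zero; suc; z≤n; s≤s; _+_; _*_; _∸_; _⊓_; _⊔_; _≤_; _<_; _≤?_)
open import Data.Nat.Properties as ℕ using ()
open import Data.Nat.Coprimality using (Coprime)
open import Data.Nat.ListAction using (sum)
open import Data.Nat.DivMod using (_%_; m≡m%n+[m/n]*n; m%n<n)
open import Data.Nat.Tactic.RingSolver using () renaming (solve-∀ to solve-ℕ-∀)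
open import Data.Integer as ℤ using (ℤ; +_; +≤+; +<+)
  renaming (_+_ to _+ᶻ_; _-_ to _-ᶻ_; _≤_ to _≤ᶻ_; _<_ to _<ᶻ_)
import Data.Integer.Properties as ℤ
open import Data.Integer.Tactic.RingSolver using (solve-∀)
open import Algebra.Properties.CommutativeSemigroup ℤ.+-commutativeSemigroup
  using () renaming (interchange to +-interchange)
open import Algebra.Properties.CommutativeSemigroup ℕ.+-commutativeSemigroup
  using () renaming (interchange to +ℕ-interchange)
open import Data.List using (List; []; _∷_; map; filter; concat; _++_)
open import Data.List.Properties using (≡-dec; foldr-preservesᵒ; ++-assoc; filter-accept)
open import Data.List.Membership.Propositional using (_∈_; _∉_)
open import Data.List.Membership.Propositional.Properties
  using (∈-++⁺ʳ; ∈-concat⁺′; ∈-concat⁻′; ∈-filter⁺; ∈-filter⁻; ∈-applyUpTo⁺; foldr-selective)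
open import Data.List.Relation.Unary.Any as Any using (here; there)
open import Data.List.Relation.Unary.All as All using (All; []; _∷_)
open import Data.List.Relation.Unary.AllPairs using (AllPairs; []; _∷_)
open import Data.List.Relation.Unary.Unique.Propositional using (Unique)
import Data.List.Relation.Unary.Unique.Propositional.Properties as Unique
open import Data.List.Relation.Binary.Disjoint.Propositional using (Disjoint)
open import Data.List.Relation.Binary.Disjoint.Propositional.Properties using () renaming (sym to Disjoint-sym)
open import Data.List.Relation.Binary.Permutation.Propositional
  using (_↭_; refl; prep; swap; trans; ↭-sym; ↭⇒↭ₛ)
open import Data.List.Relation.Binary.Permutation.Propositional.Properties
  using (map⁺; filter-↭; All-resp-↭; ∈-resp-↭; ++⁺ˡ; ++⁺; ++-comm)
import Data.List.Relation.Binary.Permutation.Setoid.Properties as Permₛ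
open import Data.Product using (_×_; _,_; proj₁; proj₂; ∃-syntax)
open import Data.Sum as Sum using (_⊎_; inj₁; inj₂; [_,_]′)
open import Data.Empty using (⊥; ⊥-elim)
open import Data.Unit using (tt)
open import Function using (_∘_)
open import Function.Bundles using (_⇔_; Equivalence; mk⇔)
open import Relation.Nullary using (¬_; Dec; yes; no)
open import Relation.Nullary.Decidable using (_×-dec_; _→-dec_)
open import Relation.Unary using (Decidable)
open import Relation.Binary.Definitions using (DecidableEquality; tri<; tri≈; tri>)
open import Relation.Binary.PropositionalEquality
  using (_≡_; _≢_; refl; sym; cong; cong₂; subst; subst₂; module ≡-Reasoning)
  renaming (trans to ≡-trans)
open import Relation.Binary.PropositionalEquality.Properties using (setoid)

private
  variable
    A : Set

-- Indicator sums and counting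

ind : {P : Set} → Dec P → ℤ → ℤ
ind (yes _) v = v
ind (no _)  _ = + 0

ind-yes : {P : Set} (P? : Dec P) {v : ℤ} → P → ind P? v ≡ v
ind-yes (yes _) _ = refl
ind-yes (no ¬p) p = ⊥-elim (¬p p)

ind-no : {P : Set} (P? : Dec P) {v : ℤ} → ¬ P → ind P? v ≡ + 0
ind-no (yes p) ¬p = ⊥-elim (¬p p)
ind-no (no _)  _  = refl

ind-zero : {P : Set} (P? : Dec P) → ind P? (+ 0) ≡ + 0
ind-zero (yes _) = refl
ind-zero (no _)  = refl

ind-cong : {P Q : Set} (P? : Dec P) (Q? : Dec Q) {v : ℤ} → (P → Q) → (Q → P) → ind P? v ≡ ind Q? v
ind-cong (yes _) (yes _) _ _ = refl
ind-cong (yes p) (no ¬q) f _ = ⊥-elim (¬q (f p))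
ind-cong (no ¬p) (yes q) _ g = ⊥-elim (¬p (g q))
ind-cong (no _)  (no _)  _ _ = refl

ind-nonneg : {P : Set} (P? : Dec P) {v : ℤ} → + 0 ≤ᶻ v → + 0 ≤ᶻ ind P? v
ind-nonneg (yes _) 0≤v = 0≤v
ind-nonneg (no _)  _   = ℤ.≤-refl

ind-⊎ : {P Q R : Set} (P? : Dec P) (Q? : Dec Q) (R? : Dec R) {v : ℤ} →
  (P ⇔ (Q ⊎ R)) → ¬ (Q × R) → ind P? v ≡ ind Q? v +ᶻ ind R? v
ind-⊎ (yes p) (yes q) (yes r) _ Q∩R = ⊥-elim (Q∩R (q , r))
ind-⊎ (yes p) (yes q) (no _)  _ _   = sym (ℤ.+-identityʳ _)
ind-⊎ (yes p) (no _)  (yes r) _ _   = sym (ℤ.+-identityˡ _)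
ind-⊎ (yes p) (no ¬q) (no ¬r) P⇔ _  = ⊥-elim ([ ¬q , ¬r ]′ (Equivalence.to P⇔ p))
ind-⊎ (no ¬p) (yes q) _       P⇔ _  = ⊥-elim (¬p (Equivalence.from P⇔ (inj₁ q)))
ind-⊎ (no ¬p) (no _)  (yes r) P⇔ _  = ⊥-elim (¬p (Equivalence.from P⇔ (inj₂ r)))
ind-⊎ (no _)  (no _)  (no _)  _ _   = refl

∑ : (A → ℤ) → List A → ℤ
∑ f xs = sumℤ (map f xs)

∑-↭ : (f : A → ℤ) {xs ys : List A} → xs ↭ ys → ∑ f xs ≡ ∑ f ys
∑-↭ f p = Permₛ.foldr-commMonoid (setoid ℤ) ℤ.+-0-isCommutativeMonoid (↭⇒↭ₛ (map⁺ f p))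

∑-cong : {f g : A → ℤ} (xs : List A) → (∀ {x} → x ∈ xs → f x ≡ g x) → ∑ f xs ≡ ∑ g xs
∑-cong []       _    = refl
∑-cong (x ∷ xs) f≗g = cong₂ _+ᶻ_ (f≗g (here refl)) (∑-cong xs (f≗g ∘ there))

∑-zero : {f : A → ℤ} (xs : List A) → (∀ {x} → x ∈ xs → f x ≡ + 0) → ∑ f xs ≡ + 0
∑-zero []       _     = refl
∑-zero (x ∷ xs) f≡0 = cong₂ _+ᶻ_ (f≡0 (here refl)) (∑-zero xs (f≡0 ∘ there))

∑-+ : (f g : A → ℤ) (xs : List A) → ∑ (λ x → f x +ᶻ g x) xs ≡ ∑ f xs +ᶻ ∑ g xs
∑-+ f g []       = refl
∑-+ f g (x ∷ xs) = ≡-trans (cong ((f x +ᶻ g x) +ᶻ_) (∑-+ f g xs)) (+-interchange (f x) (g x) _ _)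

∑-filter : {P : A → Set} (P? : Decidable P) (f : A → ℤ) (xs : List A) →
  ∑ f (filter P? xs) ≡ ∑ (λ x → ind (P? x) (f x)) xs
∑-filter P? f []       = refl
∑-filter P? f (x ∷ xs) with P? x
... | yes _ = cong (f x +ᶻ_) (∑-filter P? f xs)
... | no  _ = ≡-trans (∑-filter P? f xs) (sym (ℤ.+-identityˡ _))

∑-ind-atMostOne : {P : A → Set} (P? : Decidable P) {v : ℤ} (xs : List A) → Unique xs →
  (∀ {x y} → x ∈ xs → y ∈ xs → P x → P y → x ≡ y) → + 0 ≤ᶻ v →
  ∑ (λ x → ind (P? x) v) xs ≤ᶻ v
∑-ind-atMostOne P? []       _          _   0≤v = 0≤v
∑-ind-atMostOne P? {v} (x ∷ xs) (x∉ ∷ !xs) one 0≤v with P? x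
... | yes px = ℤ.≤-reflexive (≡-trans (cong (v +ᶻ_) (∑-zero xs λ y∈ → ind-no (P? _) (λ py →
                 All.lookup x∉ y∈ (one (here refl) (there y∈) px py))))
               (ℤ.+-identityʳ _))
... | no _   = ℤ.≤-trans (ℤ.≤-reflexive (ℤ.+-identityˡ _))
                 (∑-ind-atMostOne P? xs !xs (λ x∈ y∈ → one (there x∈) (there y∈)) 0≤v)

module _ (_≟_ : DecidableEquality A) where

  point : A → ℤ → A → ℤ
  point p v x = ind (x ≟ p) v

  ∑-ind-point : {Q : A → Set} (Q? : Decidable Q) {p : A} {v : ℤ} (xs : List A) → Unique xs → p ∈ xs →
    ∑ (λ x → ind (Q? x) (point p v x)) xs ≡ ind (Q? p) v
  ∑-ind-point Q? {v = v} (x ∷ xs) (x∉ ∷ _) (here refl) with x ≟ x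
  ... | no x≢x = ⊥-elim (x≢x refl)
  ... | yes _  = ≡-trans (cong (ind (Q? x) v +ᶻ_) (∑-zero xs zero-off)) (ℤ.+-identityʳ _)
    where
    zero-off : ∀ {y} → y ∈ xs → ind (Q? y) (point x v y) ≡ + 0
    zero-off {y} y∈ with y ≟ x
    ... | yes refl = ⊥-elim (All.lookup x∉ y∈ refl)
    ... | no _     = ind-zero (Q? y)
  ∑-ind-point Q? {p} (x ∷ xs) (x∉ ∷ !xs) (there p∈) with x ≟ p
  ... | yes refl = ⊥-elim (All.lookup x∉ p∈ refl)
  ... | no _     = ≡-trans (cong₂ _+ᶻ_ (ind-zero (Q? x)) (∑-ind-point Q? xs !xs p∈)) (ℤ.+-identityˡ _)

∑ℕ : (A → ℕ) → List A → ℕ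
∑ℕ f xs = sum (map f xs)

∑-pos : (f : A → ℕ) (xs : List A) → ∑ (λ x → + f x) xs ≡ + ∑ℕ f xs
∑-pos f []       = refl
∑-pos f (x ∷ xs) = cong (+ f x +ᶻ_) (∑-pos f xs)

∑ℕ-mono-≤ : {f g : A → ℕ} (xs : List A) → (∀ {x} → x ∈ xs → f x ≤ g x) → ∑ℕ f xs ≤ ∑ℕ g xs
∑ℕ-mono-≤ []       _    = z≤n
∑ℕ-mono-≤ (x ∷ xs) f≤g = ℕ.+-mono-≤ (f≤g (here refl)) (∑ℕ-mono-≤ xs (f≤g ∘ there))

∑ℕ-+ : (f g : A → ℕ) (xs : List A) → ∑ℕ (λ x → f x + g x) xs ≡ ∑ℕ f xs + ∑ℕ g xs
∑ℕ-+ f g []       = refl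
∑ℕ-+ f g (x ∷ xs) = ≡-trans (cong (λ s → f x + g x + s) (∑ℕ-+ f g xs)) (+ℕ-interchange (f x) (g x) _ _)

∑ℕ-*ʳ : (f : A → ℕ) (c : ℕ) (xs : List A) → ∑ℕ (λ x → f x * c) xs ≡ ∑ℕ f xs * c
∑ℕ-*ʳ f c []       = refl
∑ℕ-*ʳ f c (x ∷ xs) = ≡-trans (cong (λ s → f x * c + s) (∑ℕ-*ʳ f c xs)) (sym (ℕ.*-distribʳ-+ c (f x) _))

∈⇒≤∑ℕ : (f : A → ℕ) {x : A} {xs : List A} → x ∈ xs → f x ≤ ∑ℕ f xs
∈⇒≤∑ℕ f {xs = _ ∷ xs} (here refl) = ℕ.m≤m+n _ (∑ℕ f xs)
∈⇒≤∑ℕ f {xs = y ∷ _}  (there x∈)  = ℕ.≤-trans (∈⇒≤∑ℕ f x∈) (ℕ.m≤n+m _ (f y))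

∑[1,_] : ℕ → (ℕ → ℕ) → ℕ
∑[1, zero  ] g = 0
∑[1, suc k ] g = ∑[1, k ] g + g (suc k)

∑[1,]-∑ℕ-comm : (h : A → ℕ → ℕ) (xs : List A) (k : ℕ) →
  ∑[1, k ] (λ i → ∑ℕ (λ x → h x i) xs) ≡ ∑ℕ (λ x → ∑[1, k ] (h x)) xs
∑[1,]-∑ℕ-comm h xs zero    = sym (∑ℕ-zero xs)
  where
  ∑ℕ-zero : (xs : List A) → ∑ℕ (λ _ → 0) xs ≡ 0
  ∑ℕ-zero []       = refl
  ∑ℕ-zero (_ ∷ xs) = ∑ℕ-zero xs
∑[1,]-∑ℕ-comm h xs (suc k) =
  ≡-trans (cong (λ s → s + ∑ℕ (λ x → h x (suc k)) xs) (∑[1,]-∑ℕ-comm h xs k))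
          (sym (∑ℕ-+ (λ x → ∑[1, k ] (h x)) (λ x → h x (suc k)) xs))

∑[1,]-≥ : (g : ℕ → ℕ) (k : ℕ) → (∀ i → 1 ≤ i → i ≤ k → 1 ≤ g i) → k ≤ ∑[1, k ] g
∑[1,]-≥ g zero    _    = z≤n
∑[1,]-≥ g (suc k) 1≤g = subst (_≤ ∑[1, k ] g + g (suc k)) (ℕ.+-comm k 1)
  (ℕ.+-mono-≤ (∑[1,]-≥ g k (λ i 1≤i i≤k → 1≤g i 1≤i (ℕ.m≤n⇒m≤1+n i≤k))) (1≤g (suc k) (s≤s z≤n) ℕ.≤-refl))

inside : ℕ → ℕ → ℕ → ℕ
inside lo hi i with (lo ≤? i) ×-dec (i ≤? hi)
... | yes _ = 1
... | no _  = 0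

-- The bound suc hi ∸ lo alone is not inductive; the step needs the bound suc k ∸ lo.
∑[1,]-inside-bounds : (lo hi k : ℕ) →
  ∑[1, k ] (inside lo hi) ≤ suc k ∸ lo × ∑[1, k ] (inside lo hi) ≤ suc hi ∸ lo
∑[1,]-inside-bounds lo hi zero    = z≤n , z≤n
∑[1,]-inside-bounds lo hi (suc k) with ∑[1,]-inside-bounds lo hi k | (lo ≤? suc k) ×-dec (suc k ≤? hi)
... | ≤k , _   | yes (lo≤ , ≤hi) = step , ℕ.≤-trans step (ℕ.∸-monoˡ-≤ lo (s≤s ≤hi))
  where
  step : ∑[1, k ] (inside lo hi) + 1 ≤ suc (suc k) ∸ lo
  step = subst₂ _≤_ (ℕ.+-comm 1 _) (sym (ℕ.+-∸-assoc 1 lo≤)) (s≤s ≤k)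
... | ≤k , ≤hi | no _            rewrite ℕ.+-identityʳ (∑[1, k ] (inside lo hi)) =
  ℕ.≤-trans ≤k (ℕ.∸-monoˡ-≤ lo (ℕ.n≤1+n (suc k))) , ≤hi

inside≡1 : ∀ {lo hi i} → lo ≤ i → i ≤ hi → inside lo hi i ≡ 1
inside≡1 {lo} {hi} {i} lo≤i i≤hi with (lo ≤? i) ×-dec (i ≤? hi)
... | yes _ = refl
... | no ¬p = ⊥-elim (¬p (lo≤i , i≤hi))

∑[1,]-inside≤ : ∀ {lo hi} k → lo ≤ hi → ∑[1, k ] (inside lo hi) ≤ hi ∸ lo + 1
∑[1,]-inside≤ {lo} {hi} k lo≤hi = ℕ.≤-trans (proj₂ (∑[1,]-inside-bounds lo hi k))
  (ℕ.≤-reflexive (≡-trans (ℕ.+-∸-assoc 1 lo≤hi) (ℕ.+-comm 1 _)))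

intervals-cover : (lo hi : A → ℕ) (n : ℕ) (xs : List A) → (∀ {x} → x ∈ xs → lo x ≤ hi x) →
  (∀ i → 1 ≤ i → i ≤ n → ∃[ x ] (x ∈ xs × lo x ≤ i × i ≤ hi x)) →
  n ≤ ∑ℕ (λ x → hi x ∸ lo x + 1) xs
intervals-cover lo hi n xs lo≤hi cover = begin
  n                                                        ≤⟨ ∑[1,]-≥ _ n covered ⟩
  ∑[1, n ] (λ i → ∑ℕ (λ x → inside (lo x) (hi x) i) xs)    ≡⟨ ∑[1,]-∑ℕ-comm (λ x → inside (lo x) (hi x)) xs n ⟩
  ∑ℕ (λ x → ∑[1, n ] (inside (lo x) (hi x))) xs            ≤⟨ ∑ℕ-mono-≤ xs (λ x∈ → ∑[1,]-inside≤ n (lo≤hi x∈)) ⟩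
  ∑ℕ (λ x → hi x ∸ lo x + 1) xs                             ∎
  where
  open ℕ.≤-Reasoning
  covered : ∀ i → 1 ≤ i → i ≤ n → 1 ≤ ∑ℕ (λ x → inside (lo x) (hi x) i) xs
  covered i 1≤i i≤n with cover i 1≤i i≤n
  ... | x , x∈ , lo≤i , i≤hi =
    subst (_≤ _) (inside≡1 lo≤i i≤hi) (∈⇒≤∑ℕ (λ x → inside (lo x) (hi x) i) x∈)

Unique-[_] : ∀ m → Unique [ m ]
Unique-[ m ] = Unique.applyUpTo⁺₁ suc m (λ i<j _ → ℕ.<⇒≢ i<j ∘ ℕ.suc-injective)

concat-↭ : {xss yss : List (List A)} → xss ↭ yss → concat xss ↭ concat yss
concat-↭ refl                        = refl
concat-↭ (prep xs p)                 = ++⁺ˡ xs (concat-↭ p)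
concat-↭ (swap {xs = xss} {ys = yss} xs ys p) =
  subst₂ _↭_ (++-assoc xs ys (concat xss)) (++-assoc ys xs (concat yss)) (++⁺ (++-comm xs ys) (concat-↭ p))
concat-↭ (trans p q)                 = trans (concat-↭ p) (concat-↭ q)

Unique-++⇒Disjoint : (xs : List A) {ys : List A} → Unique (xs ++ ys) → Disjoint xs ys
Unique-++⇒Disjoint (x ∷ xs) (x∉ ∷ _)  (here refl , x∈ys) = All.lookup x∉ (∈-++⁺ʳ xs x∈ys) refl
Unique-++⇒Disjoint (x ∷ xs) (_ ∷ !xs) (there i∈xs , i∈ys) = Unique-++⇒Disjoint xs !xs (i∈xs , i∈ys)

Unique-++⁻ʳ : (xs : List A) {ys : List A} → Unique (xs ++ ys) → Unique ys
Unique-++⁻ʳ []       !ys       = !ys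
Unique-++⁻ʳ (x ∷ xs) (_ ∷ !xs) = Unique-++⁻ʳ xs !xs

Unique-concat⇒Disjoint : {xss : List (List A)} → Unique (concat xss) → AllPairs Disjoint xss
Unique-concat⇒Disjoint {xss = []}       _ = []
Unique-concat⇒Disjoint {xss = xs ∷ xss} ! =
  All.tabulate (λ ys∈ (i∈xs , i∈ys) → Unique-++⇒Disjoint xs ! (i∈xs , ∈-concat⁺′ i∈ys ys∈))
  ∷ Unique-concat⇒Disjoint (Unique-++⁻ʳ xs !)

least : {P : A → Set} (P? : Decidable P) {_≼_ : A → A → Set} →
  (∀ {x} → x ≼ x) → (∀ {x y z} → x ≼ y → y ≼ z → x ≼ z) → (xs : List A) →
  (∀ {x y} → x ∈ xs → y ∈ xs → P x → P y → x ≼ y ⊎ y ≼ x) →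
  (∀ {x} → x ∈ xs → ¬ P x) ⊎ ∃[ m ] (m ∈ xs × P m × ∀ {x} → x ∈ xs → P x → m ≼ x)
least P? ≼-refl ≼-trans [] _ = inj₁ λ ()
least P? ≼-refl ≼-trans (x ∷ xs) total
  with least P? ≼-refl ≼-trans xs (λ y∈ z∈ → total (there y∈) (there z∈)) | P? x
... | inj₁ none           | no ¬px = inj₁ λ { (here refl) → ¬px ; (there y∈) → none y∈ }
... | inj₁ none           | yes px =
  inj₂ (x , here refl , px , λ { (here refl) _ → ≼-refl ; (there y∈) py → ⊥-elim (none y∈ py) })
... | inj₂ (m , m∈ , pm , m≼) | no ¬px =
  inj₂ (m , there m∈ , pm , λ { (here refl) px → ⊥-elim (¬px px) ; (there y∈) → m≼ y∈ })
... | inj₂ (m , m∈ , pm , m≼) | yes px with total (here refl) (there m∈) px pm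
...   | inj₁ x≼m = inj₂ (x , here refl , px , λ { (here refl) _ → ≼-refl ; (there y∈) py → ≼-trans x≼m (m≼ y∈ py) })
...   | inj₂ m≼x = inj₂ (m , there m∈ , pm , λ { (here refl) _ → m≼x ; (there y∈) → m≼ y∈ })

positive-+-pred : ∀ {x y} → + 0 <ᶻ x → + 0 <ᶻ y → + 0 <ᶻ (x +ᶻ y) -ᶻ + 1
positive-+-pred {+ suc i} {+ suc j} (+<+ _) (+<+ _) = +<+ (ℕ.<-≤-trans (s≤s z≤n) (ℕ.m≤n+m (suc j) i))

module _ (m d : ℕ) where

  private
    q ρ : ℕ
    q = ceilDiv m (suc d)
    ρ = (m + d) % suc d

    division : m + d ≡ ρ + q * suc d
    division = m≡m%n+[m/n]*n (m + d) (suc d)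

  ceilDiv-lower : m ≤ ceilDiv m (suc d) * suc d
  ceilDiv-lower = ℕ.+-cancelˡ-≤ ρ m _ (begin
    ρ + m         ≡⟨ ℕ.+-comm ρ m ⟩
    m + ρ         ≤⟨ ℕ.+-monoʳ-≤ m (ℕ.≤-pred (m%n<n (m + d) (suc d))) ⟩
    m + d         ≡⟨ division ⟩
    ρ + q * suc d ∎)
    where open ℕ.≤-Reasoning

  ceilDiv-upper : ceilDiv m (suc d) * suc d < m + suc d
  ceilDiv-upper = begin-strict
    q * suc d     ≤⟨ ℕ.m≤n+m _ ρ ⟩
    ρ + q * suc d ≡⟨ division ⟨
    m + d         <⟨ ℕ.+-monoʳ-< m (ℕ.n<1+n d) ⟩
    m + suc d     ∎
    where open ℕ.≤-Reasoning

ceilDiv-+ : ∀ m n d → ceilDiv m (suc d) + ceilDiv n (suc d) ≡ ceilDiv (m + n) (suc d)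
                    ⊎ ceilDiv m (suc d) + ceilDiv n (suc d) ≡ suc (ceilDiv (m + n) (suc d))
ceilDiv-+ m n d = [ (λ sum< → inj₁ (ℕ.≤-antisym (ℕ.≤-pred sum<) ≤sum)) , inj₂ ]′ (ℕ.m≤n⇒m<n∨m≡n sum≤suc)
  where
  open ℕ.≤-Reasoning
  x y z : ℕ
  x = ceilDiv m (suc d)
  y = ceilDiv n (suc d)
  z = ceilDiv (m + n) (suc d)

  regroup₁ : ∀ x y s → x * s + y * s + s ≡ suc (x + y) * s
  regroup₁ = solve-ℕ-∀
  regroup₂ : ∀ m n s → m + s + (n + s) ≡ m + n + s + s
  regroup₂ = solve-ℕ-∀
  regroup₃ : ∀ z s → z * s + s + s ≡ suc (suc z) * s
  regroup₃ = solve-ℕ-∀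

  ≤sum : z ≤ x + y
  ≤sum = ℕ.≤-pred (ℕ.*-cancelʳ-< (suc d) z (suc (x + y)) (begin-strict
    z * suc d                       <⟨ ceilDiv-upper (m + n) d ⟩
    m + n + suc d                   ≤⟨ ℕ.+-monoˡ-≤ (suc d) (ℕ.+-mono-≤ (ceilDiv-lower m d) (ceilDiv-lower n d)) ⟩
    x * suc d + y * suc d + suc d   ≡⟨ regroup₁ x y (suc d) ⟩
    suc (x + y) * suc d             ∎))

  sum≤suc : x + y ≤ suc z
  sum≤suc = ℕ.≤-pred (ℕ.*-cancelʳ-< (suc d) (x + y) (suc (suc z)) (begin-strict
    (x + y) * suc d                 ≡⟨ ℕ.*-distribʳ-+ (suc d) x y ⟩
    x * suc d + y * suc d           <⟨ ℕ.+-mono-< (ceilDiv-upper m d) (ceilDiv-upper n d) ⟩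
    m + suc d + (n + suc d)         ≡⟨ regroup₂ m n (suc d) ⟩
    m + n + suc d + suc d           ≤⟨ ℕ.+-monoˡ-≤ (suc d) (ℕ.+-monoˡ-≤ (suc d) (ceilDiv-lower (m + n) d)) ⟩
    z * suc d + suc d + suc d       ≡⟨ regroup₃ z (suc d) ⟩
    suc (suc z) * suc d             ∎))

-- Scaling by b = suc n, the hypotheses give n a + b ≤ a b, i.e. b ≤ a.
no-excess : ∀ {n a T T′ l L′} → a < suc n → suc T + T′ ≤ a → n ≤ l + L′ →
  l * a ≤ T * suc n → L′ * a ≤ T′ * suc n → ⊥
no-excess {n} {a} {T} {T′} {l} {L′} a<b T≤a n≤L l≤T L′≤T′ =
  ℕ.<⇒≱ a<b (ℕ.+-cancelˡ-≤ (n * a) (suc n) a (begin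
    n * a + suc n                ≤⟨ ℕ.+-monoˡ-≤ (suc n) (ℕ.*-monoˡ-≤ a n≤L) ⟩
    (l + L′) * a + suc n         ≡⟨ cong (_+ suc n) (ℕ.*-distribʳ-+ a l L′) ⟩
    (l * a + L′ * a) + suc n     ≤⟨ ℕ.+-monoˡ-≤ (suc n) (ℕ.+-mono-≤ l≤T L′≤T′) ⟩
    (T * suc n + T′ * suc n) + suc n ≡⟨ regroup T T′ (suc n) ⟩
    (suc T + T′) * suc n         ≤⟨ ℕ.*-monoˡ-≤ (suc n) T≤a ⟩
    a * suc n                    ≡⟨ ℕ.*-suc a n ⟩
    a + a * n                    ≡⟨ cong₂ _+_ refl (ℕ.*-comm a n) ⟩
    a + n * a                    ≡⟨ ℕ.+-comm a (n * a) ⟩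
    n * a + a                    ∎))
  where
  open ℕ.≤-Reasoning
  regroup : ∀ T T′ b → (T * b + T′ * b) + b ≡ (suc T + T′) * b
  regroup = solve-ℕ-∀

len-split : ∀ {lo mid hi} → lo ≤ mid → mid < hi → hi ∸ lo ≡ (mid ∸ lo + 1) + (hi ∸ suc mid)
len-split {lo} lo≤mid mid<hi with ℕ.m≤n⇒∃[o]m+o≡n lo≤mid | ℕ.m≤n⇒∃[o]m+o≡n mid<hi
... | p , refl | q , refl = begin
  suc (lo + p) + q ∸ lo                  ≡⟨ cong (_∸ lo) (shift lo p q) ⟩
  lo + (p + 1 + q) ∸ lo                  ≡⟨ ℕ.m+n∸m≡n lo (p + 1 + q) ⟩
  p + 1 + q                              ≡⟨ cong₂ (λ x y → x + 1 + y) (ℕ.m+n∸m≡n lo p) (ℕ.m+n∸m≡n (suc (lo + p)) q) ⟨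
  (lo + p ∸ lo + 1) + (suc (lo + p) + q ∸ suc (lo + p)) ∎
  where
  open ≡-Reasoning
  shift : ∀ lo p q → suc (lo + p) + q ≡ lo + (p + 1 + q)
  shift = solve-ℕ-∀

-- Blocks and their spans

≤⇒<-disjoint : ∀ {X Y : List ℕ} {i j} → Disjoint X Y → i ∈ X → j ∈ Y → i ≤ j → i < j
≤⇒<-disjoint X#Y i∈X j∈Y i≤j = ℕ.≤∧≢⇒< i≤j λ { refl → X#Y (i∈X , j∈Y) }

minB-∈ : ∀ {B} → B ≢ [] → minB B ∈ B
minB-∈ {[]}     B≢[] = ⊥-elim (B≢[] refl)
minB-∈ {x ∷ xs} _    = [ here , there ]′ (foldr-selective ℕ.⊓-sel x xs)

maxB-∈ : ∀ {B} → B ≢ [] → maxB B ∈ B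
maxB-∈ {[]}     B≢[] = ⊥-elim (B≢[] refl)
maxB-∈ {x ∷ xs} _    = [ here , there ]′ (foldr-selective ℕ.⊔-sel x xs)

minB-≤ : ∀ {B i} → i ∈ B → minB B ≤ i
minB-≤ {x ∷ xs} i∈ = foldr-preservesᵒ (λ m n → [ ℕ.m≤n⇒m⊓o≤n n , ℕ.m≤n⇒o⊓m≤n m ]′) x xs (witness i∈)
  where
  witness : ∀ {i} → i ∈ x ∷ xs → x ≤ i ⊎ Any.Any (_≤ i) xs
  witness (here refl) = inj₁ ℕ.≤-refl
  witness (there i∈)  = inj₂ (Any.map (ℕ.≤-reflexive ∘ sym) i∈)

≤-maxB : ∀ {B i} → i ∈ B → i ≤ maxB B
≤-maxB {x ∷ xs} i∈ = foldr-preservesᵒ (λ m n → [ ℕ.m≤n⇒m≤n⊔o n , ℕ.m≤n⇒m≤o⊔n m ]′) x xs (witness i∈)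
  where
  witness : ∀ {i} → i ∈ x ∷ xs → i ≤ x ⊎ Any.Any (i ≤_) xs
  witness (here refl) = inj₁ ℕ.≤-refl
  witness (there i∈)  = inj₂ (Any.map ℕ.≤-reflexive i∈)

minB≤maxB : ∀ {B} → B ≢ [] → minB B ≤ maxB B
minB≤maxB B≢[] = ≤-maxB (minB-∈ B≢[])

minB-unique : ∀ {B m} → m ∈ B → (∀ {i} → i ∈ B → m ≤ i) → minB B ≡ m
minB-unique {x ∷ _} m∈ m≤ = ℕ.≤-antisym (minB-≤ m∈) (m≤ (minB-∈ λ ()))

maxB-unique : ∀ {B m} → m ∈ B → (∀ {i} → i ∈ B → i ≤ m) → maxB B ≡ m
maxB-unique {x ∷ _} m∈ ≤m = ℕ.≤-antisym (≤m (maxB-∈ λ ())) (≤-maxB m∈)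

IsUnion : Block → Block → Block → Set
IsUnion B B₀ B₁ = ∀ x → (x ∈ B) ⇔ ((x ∈ B₀) ⊎ (x ∈ B₁))

module _ {B B₀ B₁ : Block} (B=B₀∪B₁ : IsUnion B B₀ B₁) (B₀≢[] : B₀ ≢ []) (B₁≢[] : B₁ ≢ []) where

  private
    ∈B⁻ : ∀ {i} → i ∈ B → i ∈ B₀ ⊎ i ∈ B₁
    ∈B⁻ = Equivalence.to (B=B₀∪B₁ _)
    ∈B⁺ : ∀ {i} → i ∈ B₀ ⊎ i ∈ B₁ → i ∈ B
    ∈B⁺ = Equivalence.from (B=B₀∪B₁ _)

  minB-∪ : minB B ≡ minB B₀ ⊓ minB B₁
  minB-∪ = minB-unique (∈⊓ (ℕ.⊓-sel (minB B₀) (minB B₁))) (λ i∈ →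
    [ (λ i∈B₀ → ℕ.m≤n⇒m⊓o≤n _ (minB-≤ i∈B₀)) , (λ i∈B₁ → ℕ.m≤n⇒o⊓m≤n _ (minB-≤ i∈B₁)) ]′ (∈B⁻ i∈))
    where
    ∈⊓ : minB B₀ ⊓ minB B₁ ≡ minB B₀ ⊎ minB B₀ ⊓ minB B₁ ≡ minB B₁ → minB B₀ ⊓ minB B₁ ∈ B
    ∈⊓ (inj₁ eq) = subst (_∈ B) (sym eq) (∈B⁺ (inj₁ (minB-∈ B₀≢[])))
    ∈⊓ (inj₂ eq) = subst (_∈ B) (sym eq) (∈B⁺ (inj₂ (minB-∈ B₁≢[])))

  maxB-∪ : maxB B ≡ maxB B₀ ⊔ maxB B₁
  maxB-∪ = maxB-unique (∈⊔ (ℕ.⊔-sel (maxB B₀) (maxB B₁))) (λ i∈ →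
    [ (λ i∈B₀ → ℕ.m≤n⇒m≤n⊔o _ (≤-maxB i∈B₀)) , (λ i∈B₁ → ℕ.m≤n⇒m≤o⊔n _ (≤-maxB i∈B₁)) ]′ (∈B⁻ i∈))
    where
    ∈⊔ : maxB B₀ ⊔ maxB B₁ ≡ maxB B₀ ⊎ maxB B₀ ⊔ maxB B₁ ≡ maxB B₁ → maxB B₀ ⊔ maxB B₁ ∈ B
    ∈⊔ (inj₁ eq) = subst (_∈ B) (sym eq) (∈B⁺ (inj₁ (maxB-∈ B₀≢[])))
    ∈⊔ (inj₂ eq) = subst (_∈ B) (sym eq) (∈B⁺ (inj₂ (maxB-∈ B₁≢[])))

_≟ᴮ_ : DecidableEquality Block
_≟ᴮ_ = ≡-dec ℕ._≟_

⪯-refl : ∀ {X} → X ⪯ X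
⪯-refl = ℕ.≤-refl , ℕ.≤-refl

⪯-trans : ∀ {X Y Z} → X ⪯ Y → Y ⪯ Z → X ⪯ Z
⪯-trans (lo≤ , ≤hi) (lo≤′ , ≤hi′) = ℕ.≤-trans lo≤′ lo≤ , ℕ.≤-trans ≤hi ≤hi′

len : Block → ℕ
len X = maxB X ∸ minB X + 1

targetℕ : ℕ → ℕ → Block → ℕ
targetℕ a b X = ceilDiv (len X * a) b

SameSpan : Block → Block → Set
SameSpan X Y = minB X ≡ minB Y × maxB X ≡ maxB Y

⪯-respˡ-span : ∀ {X Y Z} → SameSpan X Y → X ⪯ Z → Y ⪯ Z
⪯-respˡ-span (min≡ , max≡) (lo≤ , ≤hi) = subst (_ ≤_) min≡ lo≤ , subst (_≤ _) max≡ ≤hi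

⪯-respʳ-span : ∀ {X Y Z} → SameSpan X Y → Z ⪯ X → Z ⪯ Y
⪯-respʳ-span (min≡ , max≡) (lo≤ , ≤hi) = subst (_≤ _) min≡ lo≤ , subst (_ ≤_) max≡ ≤hi

target-span : ∀ a b X Y → SameSpan X Y → target a b X ≡ target a b Y
target-span a b X Y (min≡ , max≡) = cong₂ (λ lo hi → + ceilDiv ((hi ∸ lo + 1) * a) b) min≡ max≡

-- Noncrossing partitions

module NoncrossingBlocks {n : ℕ} {σ : List Block} (ncp : NoncrossingPartition n σ) where

  nonempty : ∀ {X} → X ∈ σ → X ≢ []
  nonempty X∈ = proj₁ (All.lookup (proj₁ (proj₁ ncp)) X∈)

  disjoint : AllPairs Disjoint σ
  disjoint = Unique-concat⇒Disjoint (Permₛ.Unique-resp-↭ (setoid ℕ) (↭⇒↭ₛ (↭-sym (proj₂ (proj₁ ncp)))) Unique-[ n ])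

  blocks-unique : Unique σ
  blocks-unique = go (All.tabulate nonempty) disjoint
    where
    go : ∀ {xs} → All (_≢ []) xs → AllPairs Disjoint xs → Unique xs
    go []           []           = []
    go (X≢[] ∷ nes) (X# ∷ pairs) = All.map (λ { X#X refl → X#X (minB-∈ X≢[] , minB-∈ X≢[]) }) X# ∷ go nes pairs

  shared⇒≡ : ∀ {X Y i} → X ∈ σ → Y ∈ σ → i ∈ X → i ∈ Y → X ≡ Y
  shared⇒≡ = go disjoint
    where
    go : ∀ {xs X Y i} → AllPairs Disjoint xs → X ∈ xs → Y ∈ xs → i ∈ X → i ∈ Y → X ≡ Y
    go _            (here refl) (here refl) _   _   = refl
    go (X# ∷ _)     (here refl) (there Y∈)  i∈X i∈Y = ⊥-elim (All.lookup X# Y∈ (i∈X , i∈Y))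
    go (Y# ∷ _)     (there X∈)  (here refl) i∈X i∈Y = ⊥-elim (All.lookup Y# X∈ (i∈Y , i∈X))
    go (_ ∷ pairs)  (there X∈)  (there Y∈)  i∈X i∈Y = go pairs X∈ Y∈ i∈X i∈Y

  covers : ∀ i → 1 ≤ i → i ≤ n → ∃[ X ] (i ∈ X × X ∈ σ)
  covers (suc i) _ i<n = ∈-concat⁻′ σ (∈-resp-↭ (↭-sym (proj₂ (proj₁ ncp))) (∈-applyUpTo⁺ suc i<n))

  ⪯-antisym : ∀ {X Y} → X ∈ σ → Y ∈ σ → X ⪯ Y → Y ⪯ X → X ≡ Y
  ⪯-antisym X∈ Y∈ (lo≥ , _) (lo≤ , _) =
    shared⇒≡ X∈ Y∈ (minB-∈ (nonempty X∈)) (subst (_∈ _) (ℕ.≤-antisym lo≥ lo≤) (minB-∈ (nonempty Y∈)))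

  no-interleaving : ∀ {X Y i j k l} → X ∈ σ → Y ∈ σ → Disjoint X Y →
    i ∈ X → k ∈ X → j ∈ Y → l ∈ Y → i < j → j < k → k < l → ⊥
  no-interleaving {X} X∈ Y∈ X#Y i∈X k∈X j∈Y l∈Y i<j j<k k<l =
    proj₂ ncp _ _ _ _ i<j j<k k<l (X , X∈ , i∈X , k∈X) (_ , Y∈ , j∈Y , l∈Y) λ where
      (Z , Z∈ , i∈Z , j∈Z) → X#Y (subst (_ ∈_) (shared⇒≡ Z∈ X∈ i∈Z i∈X) j∈Z , j∈Y)

  private
    nested-right : ∀ {X Y} → X ∈ σ → Y ∈ σ → Disjoint X Y →
      minB X < minB Y → minB Y ≤ maxB X → Y ⪯ X
    nested-right {X} {Y} X∈ Y∈ X#Y minX<minY minY≤maxX with maxB Y ≤? maxB X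
    ... | yes maxY≤maxX = ℕ.<⇒≤ minX<minY , maxY≤maxX
    ... | no  maxY≰maxX = ⊥-elim (no-interleaving X∈ Y∈ X#Y
          (minB-∈ (nonempty X∈)) (maxB-∈ (nonempty X∈)) (minB-∈ (nonempty Y∈)) (maxB-∈ (nonempty Y∈))
          minX<minY (≤⇒<-disjoint (Disjoint-sym X#Y) (minB-∈ (nonempty Y∈)) (maxB-∈ (nonempty X∈)) minY≤maxX)
          (ℕ.≰⇒> maxY≰maxX))

  overlapping⇒nested : ∀ {X Y} → X ∈ σ → Y ∈ σ → Disjoint X Y →
    minB X ≤ maxB Y → minB Y ≤ maxB X → X ⪯ Y ⊎ Y ⪯ X
  overlapping⇒nested {X} {Y} X∈ Y∈ X#Y minX≤maxY minY≤maxX with ℕ.<-cmp (minB X) (minB Y)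
  ... | tri< minX<minY _ _ = inj₂ (nested-right X∈ Y∈ X#Y minX<minY minY≤maxX)
  ... | tri> _ _ minY<minX = inj₁ (nested-right Y∈ X∈ (Disjoint-sym X#Y) minY<minX minX≤maxY)
  ... | tri≈ _ minX≡minY _ = ⊥-elim (X#Y (minB-∈ (nonempty X∈) , subst (_∈ Y) (sym minX≡minY) (minB-∈ (nonempty Y∈))))

  above-comparable : ∀ {X Y Z} → X ∈ σ → Y ∈ σ → Z ∈ σ → Z ⪯ X → Z ⪯ Y → X ⪯ Y ⊎ Y ⪯ X
  above-comparable {X} {Y} {Z} X∈ Y∈ Z∈ (minX≤minZ , maxZ≤maxX) (minY≤minZ , maxZ≤maxY) with X ≟ᴮ Y
  ... | yes refl = inj₁ (⪯-refl {X})
  ... | no X≢Y   = overlapping⇒nested X∈ Y∈ (λ (i∈X , i∈Y) → X≢Y (shared⇒≡ X∈ Y∈ i∈X i∈Y))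
    (ℕ.≤-trans minX≤minZ (ℕ.≤-trans (minB≤maxB (nonempty Z∈)) maxZ≤maxY))
    (ℕ.≤-trans minY≤minZ (ℕ.≤-trans (minB≤maxB (nonempty Z∈)) maxZ≤maxX))

  Maximal : Block → Set
  Maximal R = All (λ Y → R ⪯ Y → Y ⪯ R) σ

  Maximal? : Decidable Maximal
  Maximal? R = All.all? (λ Y → (R ⪯? Y) →-dec (Y ⪯? R)) σ

  maximal-above : ∀ {X} → X ∈ σ → ∃[ R ] (R ∈ σ × Maximal R × X ⪯ R)
  maximal-above {X} X∈
    with least (X ⪯?_) {λ R R′ → R′ ⪯ R} (λ {R} → ⪯-refl {R}) (λ {R} {R′} {R″} p q → ⪯-trans {R″} {R′} {R} q p) σ
           (λ R∈ R′∈ X⪯R X⪯R′ → [ inj₂ , inj₁ ]′ (above-comparable R∈ R′∈ X∈ X⪯R X⪯R′))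
  ... | inj₁ none                   = ⊥-elim (none X∈ (⪯-refl {X}))
  ... | inj₂ (R , R∈ , X⪯R , R-top) =
    R , R∈ , All.tabulate (λ {Y} Y∈ R⪯Y → R-top Y∈ (⪯-trans {X} {R} {Y} X⪯R R⪯Y)) , X⪯R

  maximal-unique : ∀ {X R R′} → X ∈ σ → R ∈ σ → R′ ∈ σ → Maximal R → Maximal R′ → X ⪯ R → X ⪯ R′ → R ≡ R′
  maximal-unique X∈ R∈ R′∈ max-R max-R′ X⪯R X⪯R′ with above-comparable R∈ R′∈ X∈ X⪯R X⪯R′
  ... | inj₁ R⪯R′ = ⪯-antisym R∈ R′∈ R⪯R′ (All.lookup max-R R′∈ R⪯R′)
  ... | inj₂ R′⪯R = ⪯-antisym R∈ R′∈ (All.lookup max-R′ R∈ R′⪯R) R′⪯R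

  maximal-blocks : List Block
  maximal-blocks = filter Maximal? σ

  maximal-blocks-cover : n ≤ ∑ℕ len maximal-blocks
  maximal-blocks-cover = intervals-cover minB maxB n maximal-blocks
    (λ R∈ → minB≤maxB (nonempty (proj₁ (∈-filter⁻ Maximal? R∈))))
    λ i 1≤i i≤n → let (X , i∈X , X∈) = covers i 1≤i i≤n
                      (R , R∈ , max-R , (minR≤minX , maxX≤maxR)) = maximal-above X∈
                  in R , ∈-filter⁺ Maximal? R∈ max-R
                       , ℕ.≤-trans minR≤minX (minB-≤ i∈X) , ℕ.≤-trans (≤-maxB i∈X) maxX≤maxR

HasValidRanking-resp-↭ : ∀ {a b π π′} → π ↭ π′ → HasValidRanking a b π → HasValidRanking a b π′
HasValidRanking-resp-↭ p (r , rank , positive , total) =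
    r
  , All-resp-↭ p (All.map (λ {B} eq → ≡-trans (∑-↭ r (filter-↭ (_⪯? B) (↭-sym p))) eq) rank)
  , All-resp-↭ p positive
  , ≡-trans (∑-↭ r (↭-sym p)) total

NoncrossingPartition-resp-↭ : ∀ {n π π′} → π ↭ π′ → NoncrossingPartition n π → NoncrossingPartition n π′
NoncrossingPartition-resp-↭ p ((nonempty , covering) , noncrossing) =
    (All-resp-↭ p nonempty , trans (concat-↭ (↭-sym p)) covering)
  , λ i j k l i<j j<k k<l i∼k j∼l i≁j →
      noncrossing i j k l i<j j<k k<l (same (↭-sym p) i∼k) (same (↭-sym p) j∼l) (i≁j ∘ same p)
  where
  same : ∀ {π π′ i j} → π ↭ π′ → SameBlock π i j → SameBlock π′ i j
  same p (B , B∈ , i∈ , j∈) = B , ∈-resp-↭ p B∈ , i∈ , j∈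

-- Rank equations

below : (Block → ℤ) → Block → List Block → ℤ
below r X ys = ∑ (λ Y → ind (Y ⪯? X) (r Y)) ys

below-cong : ∀ {f g : Block → ℤ} X ys → (∀ {Y} → Y ∈ ys → f Y ≡ g Y) → below f X ys ≡ below g X ys
below-cong X ys f≗g = ∑-cong ys (λ {Y} Y∈ → cong (ind (Y ⪯? X)) (f≗g Y∈))

below-+ : ∀ (f g : Block → ℤ) X ys → below (λ Y → f Y +ᶻ g Y) X ys ≡ below f X ys +ᶻ below g X ys
below-+ f g X ys = ≡-trans (∑-cong ys λ {Y} _ → ind-+ (Y ⪯? X)) (∑-+ _ _ ys)
  where
  ind-+ : {P : Set} (P? : Dec P) {u v : ℤ} → ind P? (u +ᶻ v) ≡ ind P? u +ᶻ ind P? v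
  ind-+ (yes _) = refl
  ind-+ (no _)  = refl

IsRank⇒below : ∀ {a b σ r X} → IsRank a b σ r → X ∈ σ → below r X σ ≡ target a b X
IsRank⇒below {σ = σ} {r} {X} rank X∈ = ≡-trans (sym (∑-filter (_⪯? X) r σ)) (All.lookup rank X∈)

below⇒IsRank : ∀ {a b σ r} → (∀ {X} → X ∈ σ → below r X σ ≡ target a b X) → IsRank a b σ r
below⇒IsRank {σ = σ} {r} eqs = All.tabulate λ {X} X∈ → ≡-trans (∑-filter (_⪯? X) r σ) (eqs X∈)

below-⊎ : ∀ r X X₀ X₁ ys → (∀ {Y} → Y ∈ ys → (Y ⪯ X) ⇔ (Y ⪯ X₀ ⊎ Y ⪯ X₁)) →
  (∀ {Y} → Y ∈ ys → ¬ (Y ⪯ X₀ × Y ⪯ X₁)) → below r X ys ≡ below r X₀ ys +ᶻ below r X₁ ys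
below-⊎ r X X₀ X₁ ys split exclusive =
  ≡-trans (∑-cong ys λ {Y} Y∈ → ind-⊎ (Y ⪯? X) (Y ⪯? X₀) (Y ⪯? X₁) (split Y∈) (exclusive Y∈)) (∑-+ _ _ ys)

below-span : ∀ r X Y ys → SameSpan X Y → below r X ys ≡ below r Y ys
below-span r X Y ys span = ∑-cong ys λ {Z} _ →
  ind-cong (Z ⪯? X) (Z ⪯? Y) (⪯-respʳ-span {X} {Y} {Z} span) (⪯-respʳ-span {Y} {X} {Z} (sym (proj₁ span) , sym (proj₂ span)))

below-double-count : (r : Block → ℤ) (Rs ys : List Block) → Unique Rs →
  (∀ {Y R R′} → Y ∈ ys → R ∈ Rs → R′ ∈ Rs → Y ⪯ R → Y ⪯ R′ → R ≡ R′) →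
  (∀ {Y} → Y ∈ ys → + 0 ≤ᶻ r Y) →
  ∑ (λ R → below r R ys) Rs ≤ᶻ ∑ r ys
below-double-count r Rs []       _   _       _      = ℤ.≤-reflexive (∑-zero Rs λ _ → refl)
below-double-count r Rs (Y ∷ ys) !Rs one-top 0≤r = begin
  ∑ (λ R → ind (Y ⪯? R) (r Y) +ᶻ below r R ys) Rs            ≡⟨ ∑-+ _ _ Rs ⟩
  ∑ (λ R → ind (Y ⪯? R) (r Y)) Rs +ᶻ ∑ (λ R → below r R ys) Rs ≤⟨ ℤ.+-mono-≤
      (∑-ind-atMostOne (Y ⪯?_) Rs !Rs (one-top (here refl)) (0≤r (here refl)))
      (below-double-count r Rs ys !Rs (one-top ∘ there) (0≤r ∘ there)) ⟩
  r Y +ᶻ ∑ r ys                                               ∎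
  where open ℤ.≤-Reasoning

module _ {n a b : ℕ} {σ : List Block} {r : Block → ℤ} (ncp : NoncrossingPartition n σ) where

  open NoncrossingBlocks ncp

  ∑-target-maximal≤ : IsRank a b σ r → (∀ {Y} → Y ∈ σ → + 0 ≤ᶻ r Y) → ∑ (target a b) maximal-blocks ≤ᶻ ∑ r σ
  ∑-target-maximal≤ rank 0≤r = begin
    ∑ (target a b) maximal-blocks        ≡⟨ ∑-cong maximal-blocks (λ R∈ → IsRank⇒below {a} {b} rank (in-σ R∈)) ⟨
    ∑ (λ R → below r R σ) maximal-blocks ≤⟨ below-double-count r maximal-blocks σ
        (Unique.filter⁺ Maximal? blocks-unique)
        (λ Y∈ R∈ R′∈ → maximal-unique Y∈ (in-σ R∈) (in-σ R′∈) (is-max R∈) (is-max R′∈)) 0≤r ⟩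
    ∑ r σ                                ∎
    where
    open ℤ.≤-Reasoning
    in-σ : ∀ {R} → R ∈ maximal-blocks → R ∈ σ
    in-σ = proj₁ ∘ ∈-filter⁻ Maximal? {xs = σ}
    is-max : ∀ {R} → R ∈ maximal-blocks → Maximal R
    is-max = proj₂ ∘ ∈-filter⁻ Maximal? {xs = σ}

-- Ranks after merging two blocks

SameBlocksAbove : Block → Block → List Block → Set
SameBlocksAbove X Y ys = ∀ {Z} → Z ∈ ys → (X ⪯ Z) ⇔ (Y ⪯ Z)

module Merge {a b : ℕ} {B₀ B₁ B : Block} {ρ : List Block} {r : Block → ℤ}
  (rank : IsRank a b (B₀ ∷ B₁ ∷ ρ) r)
  (positive : All (λ Y → + 0 <ᶻ r Y) (B₀ ∷ B₁ ∷ ρ))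
  (total : ∑ r (B₀ ∷ B₁ ∷ ρ) ≡ + a)
  (B∉ρ : B ∉ ρ)
  (B~B₀ : SameBlocksAbove B B₀ ρ)
  (B₁~B₀ : SameBlocksAbove B₁ B₀ ρ)
  where

  private
    t : Block → ℤ
    t = target a b

    regroup : ∀ v R C → v +ᶻ (R +ᶻ C) ≡ (v +ᶻ C) +ᶻ R
    regroup = solve-∀

    rank-above : ∀ {X} → X ∈ ρ → B₀ ⪯ X → (r B₀ +ᶻ r B₁) +ᶻ below r X ρ ≡ t X
    rank-above {X} X∈ B₀⪯X = begin
      (r B₀ +ᶻ r B₁) +ᶻ below r X ρ                                  ≡⟨ ℤ.+-assoc (r B₀) (r B₁) _ ⟩
      r B₀ +ᶻ (r B₁ +ᶻ below r X ρ)                                  ≡⟨ cong₂ (λ u w → u +ᶻ (w +ᶻ below r X ρ))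
                                                                          (ind-yes (B₀ ⪯? X) B₀⪯X)
          (ind-yes (B₁ ⪯? X) (Equivalence.from (B₁~B₀ X∈) B₀⪯X)) ⟨
      ind (B₀ ⪯? X) (r B₀) +ᶻ (ind (B₁ ⪯? X) (r B₁) +ᶻ below r X ρ) ≡⟨ IsRank⇒below {a} {b} rank (there (there X∈)) ⟩
      t X                                                            ∎
      where open ≡-Reasoning

    rank-elsewhere : ∀ {X} → X ∈ ρ → ¬ B₀ ⪯ X → below r X ρ ≡ t X
    rank-elsewhere {X} X∈ B₀⋠X = begin
      below r X ρ                                                    ≡⟨ ≡-trans (ℤ.+-identityˡ _) (ℤ.+-identityˡ _) ⟨
      + 0 +ᶻ (+ 0 +ᶻ below r X ρ)                                    ≡⟨ cong₂ (λ u w → u +ᶻ (w +ᶻ below r X ρ))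
                                                                          (ind-no (B₀ ⪯? X) B₀⋠X)
          (ind-no (B₁ ⪯? X) (B₀⋠X ∘ Equivalence.to (B₁~B₀ X∈))) ⟨
      ind (B₀ ⪯? X) (r B₀) +ᶻ (ind (B₁ ⪯? X) (r B₁) +ᶻ below r X ρ) ≡⟨ IsRank⇒below {a} {b} rank (there (there X∈)) ⟩
      t X                                                            ∎
      where open ≡-Reasoning

    module Reassign (v : ℤ) (c : Block → ℤ) where

      r′ : Block → ℤ
      r′ Y with Y ≟ᴮ B
      ... | yes _ = v
      ... | no  _ = r Y +ᶻ c Y

      r′-B : r′ B ≡ v
      r′-B with B ≟ᴮ B
      ... | yes _  = refl
      ... | no B≢B = ⊥-elim (B≢B refl)

      r′-ρ : ∀ {Y} → Y ∈ ρ → r′ Y ≡ r Y +ᶻ c Y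
      r′-ρ {Y} Y∈ with Y ≟ᴮ B
      ... | yes refl = ⊥-elim (B∉ρ Y∈)
      ... | no _     = refl

      below-r′ : ∀ X → below r′ X ρ ≡ below r X ρ +ᶻ below c X ρ
      below-r′ X = ≡-trans (below-cong X ρ r′-ρ) (below-+ r c X ρ)

      reassign : v +ᶻ (below r B ρ +ᶻ below c B ρ) ≡ t B →
        (∀ {X} → X ∈ ρ → B₀ ⪯ X → v +ᶻ below c X ρ ≡ r B₀ +ᶻ r B₁) →
        (∀ {X} → X ∈ ρ → ¬ B₀ ⪯ X → below c X ρ ≡ + 0) →
        + 0 <ᶻ v → (∀ {Y} → Y ∈ ρ → + 0 ≤ᶻ c Y) → v +ᶻ ∑ c ρ ≡ r B₀ +ᶻ r B₁ →
        HasValidRanking a b (B ∷ ρ)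
      reassign rank-B c-above c-elsewhere 0<v 0≤c c-total = r′ , below⇒IsRank {a} {b} rank′ , positive′ , total′
        where
        rank′ : ∀ {X} → X ∈ B ∷ ρ → below r′ X (B ∷ ρ) ≡ t X
        rank′ (here refl) = begin
          ind (B ⪯? B) (r′ B) +ᶻ below r′ B ρ  ≡⟨ cong₂ _+ᶻ_ (≡-trans (ind-yes (B ⪯? B) (⪯-refl {B})) r′-B) (below-r′ B) ⟩
          v +ᶻ (below r B ρ +ᶻ below c B ρ)    ≡⟨ rank-B ⟩
          t B                                  ∎
          where open ≡-Reasoning
        rank′ {X} (there X∈) with B₀ ⪯? X
        ... | yes B₀⪯X = begin
          ind (B ⪯? X) (r′ B) +ᶻ below r′ X ρ  ≡⟨ cong₂ _+ᶻ_ (≡-trans (ind-yes (B ⪯? X) (Equivalence.from (B~B₀ X∈) B₀⪯X)) r′-B)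
                                                             (below-r′ X) ⟩
          v +ᶻ (below r X ρ +ᶻ below c X ρ)    ≡⟨ regroup v _ _ ⟩
          (v +ᶻ below c X ρ) +ᶻ below r X ρ    ≡⟨ cong (_+ᶻ below r X ρ) (c-above X∈ B₀⪯X) ⟩
          (r B₀ +ᶻ r B₁) +ᶻ below r X ρ        ≡⟨ rank-above X∈ B₀⪯X ⟩
          t X                                  ∎
          where open ≡-Reasoning
        ... | no B₀⋠X = begin
          ind (B ⪯? X) (r′ B) +ᶻ below r′ X ρ  ≡⟨ cong₂ _+ᶻ_ (ind-no (B ⪯? X) (B₀⋠X ∘ Equivalence.to (B~B₀ X∈))) (below-r′ X) ⟩
          + 0 +ᶻ (below r X ρ +ᶻ below c X ρ)  ≡⟨ ℤ.+-identityˡ _ ⟩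
          below r X ρ +ᶻ below c X ρ           ≡⟨ cong (below r X ρ +ᶻ_) (c-elsewhere X∈ B₀⋠X) ⟩
          below r X ρ +ᶻ + 0                   ≡⟨ ℤ.+-identityʳ _ ⟩
          below r X ρ                          ≡⟨ rank-elsewhere X∈ B₀⋠X ⟩
          t X                                  ∎
          where open ≡-Reasoning

        positive′ : All (λ Y → + 0 <ᶻ r′ Y) (B ∷ ρ)
        positive′ = subst (+ 0 <ᶻ_) (sym r′-B) 0<v
                  ∷ All.tabulate λ Y∈ → subst (+ 0 <ᶻ_) (sym (r′-ρ Y∈))
                      (ℤ.+-mono-<-≤ (All.lookup positive (there (there Y∈))) (0≤c Y∈))

        total′ : ∑ r′ (B ∷ ρ) ≡ + a
        total′ = begin
          r′ B +ᶻ ∑ r′ ρ                  ≡⟨ cong₂ _+ᶻ_ r′-B (≡-trans (∑-cong ρ r′-ρ) (∑-+ r c ρ)) ⟩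
          v +ᶻ (∑ r ρ +ᶻ ∑ c ρ)           ≡⟨ regroup v _ _ ⟩
          (v +ᶻ ∑ c ρ) +ᶻ ∑ r ρ           ≡⟨ cong (_+ᶻ ∑ r ρ) c-total ⟩
          (r B₀ +ᶻ r B₁) +ᶻ ∑ r ρ         ≡⟨ ℤ.+-assoc (r B₀) (r B₁) _ ⟩
          r B₀ +ᶻ (r B₁ +ᶻ ∑ r ρ)         ≡⟨ total ⟩
          + a                             ∎
          where open ≡-Reasoning

  merge : (r B₀ +ᶻ r B₁) +ᶻ below r B ρ ≡ target a b B → HasValidRanking a b (B ∷ ρ)
  merge exact = reassign
      (≡-trans (cong (λ w → v +ᶻ (below r B ρ +ᶻ w)) (below-0 B))
        (≡-trans (cong (v +ᶻ_) (ℤ.+-identityʳ (below r B ρ))) exact))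
      (λ {X} _ _ → ≡-trans (cong (v +ᶻ_) (below-0 X)) (ℤ.+-identityʳ v))
      (λ {X} _ _ → below-0 X)
      (ℤ.+-mono-< (All.lookup positive (here refl)) (All.lookup positive (there (here refl))))
      (λ _ → ℤ.≤-refl)
      (≡-trans (cong (v +ᶻ_) (∑-zero ρ λ _ → refl)) (ℤ.+-identityʳ v))
    where
    v : ℤ
    v = r B₀ +ᶻ r B₁
    open Reassign v (λ _ → + 0)
    below-0 : ∀ X → below (λ _ → + 0) X ρ ≡ + 0
    below-0 X = ∑-zero ρ λ {Y} _ → ind-zero (Y ⪯? X)

  -- The surplus unit of rank moves from B to the least block P above B₀.
  merge-via-parent : Unique ρ → (r B₀ +ᶻ r B₁) +ᶻ below r B ρ ≡ target a b B +ᶻ + 1 →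
    ∀ {P} → P ∈ ρ → (∀ {X} → X ∈ ρ → B₀ ⪯ X → P ⪯ X) → B₀ ⪯ P → ¬ P ⪯ B →
    HasValidRanking a b (B ∷ ρ)
  merge-via-parent !ρ excess {P} P∈ P-least B₀⪯P P⋠B =
    reassign rank-B c-above c-elsewhere 0<v (λ {Y} _ → ind-nonneg (Y ≟ᴮ P) (+≤+ z≤n)) c-total
    where
    s v : ℤ
    s = r B₀ +ᶻ r B₁
    v = s -ᶻ + 1
    c : Block → ℤ
    c = point _≟ᴮ_ P (+ 1)
    open Reassign v c

    pred-+1 : ∀ x → (x -ᶻ + 1) +ᶻ + 1 ≡ x
    pred-+1 = solve-∀
    +1-pred : ∀ x → (x +ᶻ + 1) -ᶻ + 1 ≡ x
    +1-pred = solve-∀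
    pred-+ : ∀ x y → (x -ᶻ + 1) +ᶻ y ≡ (x +ᶻ y) -ᶻ + 1
    pred-+ = solve-∀

    below-c : ∀ X → below c X ρ ≡ ind (P ⪯? X) (+ 1)
    below-c X = ∑-ind-point _≟ᴮ_ (_⪯? X) ρ !ρ P∈

    rank-B : v +ᶻ (below r B ρ +ᶻ below c B ρ) ≡ target a b B
    rank-B = begin
      v +ᶻ (below r B ρ +ᶻ below c B ρ)   ≡⟨ cong (λ w → v +ᶻ (below r B ρ +ᶻ w)) (≡-trans (below-c B) (ind-no (P ⪯? B) P⋠B)) ⟩
      v +ᶻ (below r B ρ +ᶻ + 0)           ≡⟨ cong (v +ᶻ_) (ℤ.+-identityʳ (below r B ρ)) ⟩
      v +ᶻ below r B ρ                    ≡⟨ pred-+ s (below r B ρ) ⟩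
      (s +ᶻ below r B ρ) -ᶻ + 1           ≡⟨ cong (_-ᶻ + 1) excess ⟩
      (target a b B +ᶻ + 1) -ᶻ + 1        ≡⟨ +1-pred (target a b B) ⟩
      target a b B                        ∎
      where open ≡-Reasoning

    c-above : ∀ {X} → X ∈ ρ → B₀ ⪯ X → v +ᶻ below c X ρ ≡ s
    c-above {X} X∈ B₀⪯X = ≡-trans (cong (v +ᶻ_) (≡-trans (below-c X) (ind-yes (P ⪯? X) (P-least X∈ B₀⪯X)))) (pred-+1 s)

    c-elsewhere : ∀ {X} → X ∈ ρ → ¬ B₀ ⪯ X → below c X ρ ≡ + 0
    c-elsewhere {X} _ B₀⋠X = ≡-trans (below-c X) (ind-no (P ⪯? X) (B₀⋠X ∘ ⪯-trans {B₀} {P} {X} B₀⪯P))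

    c-total : v +ᶻ ∑ c ρ ≡ s
    c-total = ≡-trans (cong (v +ᶻ_) (∑-ind-point _≟ᴮ_ (λ _ → yes tt) ρ !ρ P∈)) (pred-+1 s)

    0<v : + 0 <ᶻ v
    0<v = positive-+-pred (All.lookup positive (here refl)) (All.lookup positive (there (here refl)))

module Merging {n a : ℕ} {B₀ B₁ B : Block} {ρ : List Block} {r : Block → ℤ} (a<b : a < suc n)
  (ncp : NoncrossingPartition n (B₀ ∷ B₁ ∷ ρ)) (ncp′ : NoncrossingPartition n (B ∷ ρ))
  (B=B₀∪B₁ : IsUnion B B₀ B₁)
  (rank : IsRank a (suc n) (B₀ ∷ B₁ ∷ ρ) r)
  (positive : All (λ Y → + 0 <ᶻ r Y) (B₀ ∷ B₁ ∷ ρ))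
  (total : ∑ r (B₀ ∷ B₁ ∷ ρ) ≡ + a)
  where

  open NoncrossingBlocks ncp
  module σ′ = NoncrossingBlocks ncp′

  private
    t : Block → ℤ
    t = target a (suc n)

    B₀∈ : B₀ ∈ B₀ ∷ B₁ ∷ ρ
    B₀∈ = here refl
    B₁∈ : B₁ ∈ B₀ ∷ B₁ ∷ ρ
    B₁∈ = there (here refl)
    ρ⊆ : ∀ {X} → X ∈ ρ → X ∈ B₀ ∷ B₁ ∷ ρ
    ρ⊆ = there ∘ there

    B₀≢[] : B₀ ≢ []
    B₀≢[] = nonempty B₀∈
    B₁≢[] : B₁ ≢ []
    B₁≢[] = nonempty B₁∈

    B₀#ρ : ∀ {X} → X ∈ ρ → Disjoint B₀ X
    B₀#ρ X∈ with disjoint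
    ... | (_ ∷ B₀#ρ) ∷ _ = All.lookup B₀#ρ X∈

    B₁#ρ : ∀ {X} → X ∈ ρ → Disjoint B₁ X
    B₁#ρ X∈ with disjoint
    ... | _ ∷ B₁#ρ ∷ _ = All.lookup B₁#ρ X∈

    B#ρ : ∀ {X} → X ∈ ρ → Disjoint B X
    B#ρ X∈ with σ′.disjoint
    ... | B#ρ ∷ _ = All.lookup B#ρ X∈

    B∉ρ : B ∉ ρ
    B∉ρ B∈ = B#ρ B∈ (minB-∈ (σ′.nonempty (here refl)) , minB-∈ (σ′.nonempty (here refl)))

    ρ-unique : Unique ρ
    ρ-unique with blocks-unique
    ... | _ ∷ _ ∷ !ρ = !ρ

    ∈B₀ : ∀ {i} → i ∈ B₀ → i ∈ B
    ∈B₀ = Equivalence.from (B=B₀∪B₁ _) ∘ inj₁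
    ∈B₁ : ∀ {i} → i ∈ B₁ → i ∈ B
    ∈B₁ = Equivalence.from (B=B₀∪B₁ _) ∘ inj₂

  nested : B₀ ⪯ B₁ → HasValidRanking a (suc n) (B ∷ ρ)
  nested (minB₁≤minB₀ , maxB₀≤maxB₁) = merge (begin
    (r B₀ +ᶻ r B₁) +ᶻ below r B ρ                                    ≡⟨ cong ((r B₀ +ᶻ r B₁) +ᶻ_) (below-span r B B₁ ρ span) ⟩
    (r B₀ +ᶻ r B₁) +ᶻ below r B₁ ρ                                   ≡⟨ ℤ.+-assoc (r B₀) (r B₁) _ ⟩
    r B₀ +ᶻ (r B₁ +ᶻ below r B₁ ρ)                                   ≡⟨ cong₂ (λ u w → u +ᶻ (w +ᶻ below r B₁ ρ))
        (ind-yes (B₀ ⪯? B₁) B₀⪯B₁) (ind-yes (B₁ ⪯? B₁) (⪯-refl {B₁})) ⟨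
    ind (B₀ ⪯? B₁) (r B₀) +ᶻ (ind (B₁ ⪯? B₁) (r B₁) +ᶻ below r B₁ ρ) ≡⟨ IsRank⇒below {a} {suc n} rank B₁∈ ⟩
    t B₁                                                             ≡⟨ target-span a (suc n) B B₁ span ⟨
    t B                                                              ∎)
    where
    open ≡-Reasoning
    B₀⪯B₁ : B₀ ⪯ B₁
    B₀⪯B₁ = minB₁≤minB₀ , maxB₀≤maxB₁

    span : SameSpan B B₁
    span = ≡-trans (minB-∪ B=B₀∪B₁ B₀≢[] B₁≢[]) (ℕ.m≥n⇒m⊓n≡n minB₁≤minB₀)
         , ≡-trans (maxB-∪ B=B₀∪B₁ B₀≢[] B₁≢[]) (ℕ.m≤n⇒m⊔n≡n maxB₀≤maxB₁)

    -- A block between B₀ and B₁ would interleave with the merged block B.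
    B₀⪯⇒B₁⪯ : ∀ {X} → X ∈ ρ → B₀ ⪯ X → B₁ ⪯ X
    B₀⪯⇒B₁⪯ {X} X∈ (minX≤minB₀ , maxB₀≤maxX) with overlapping⇒nested B₁∈ (ρ⊆ X∈) (B₁#ρ X∈)
      (ℕ.≤-trans minB₁≤minB₀ (ℕ.≤-trans (minB≤maxB B₀≢[]) maxB₀≤maxX))
      (ℕ.≤-trans minX≤minB₀ (ℕ.≤-trans (minB≤maxB B₀≢[]) maxB₀≤maxB₁))
    ... | inj₁ B₁⪯X         = B₁⪯X
    ... | inj₂ (_ , maxX≤maxB₁) = ⊥-elim (σ′.no-interleaving (there X∈) (here refl) (Disjoint-sym (B#ρ X∈))
          (minB-∈ X≢[]) (maxB-∈ X≢[]) (∈B₀ (minB-∈ B₀≢[])) (∈B₁ (maxB-∈ B₁≢[]))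
          (≤⇒<-disjoint (Disjoint-sym (B₀#ρ X∈)) (minB-∈ X≢[]) (minB-∈ B₀≢[]) minX≤minB₀)
          (≤⇒<-disjoint (B₀#ρ X∈) (minB-∈ B₀≢[]) (maxB-∈ X≢[]) (ℕ.≤-trans (minB≤maxB B₀≢[]) maxB₀≤maxX))
          (≤⇒<-disjoint (Disjoint-sym (B₁#ρ X∈)) (maxB-∈ X≢[]) (maxB-∈ B₁≢[]) maxX≤maxB₁))
      where
      X≢[] : X ≢ []
      X≢[] = nonempty (ρ⊆ X∈)

    B₁~B₀ : SameBlocksAbove B₁ B₀ ρ
    B₁~B₀ {X} X∈ = mk⇔ (λ B₁⪯X → ⪯-trans {B₀} {B₁} {X} B₀⪯B₁ B₁⪯X) (B₀⪯⇒B₁⪯ X∈)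

    B~B₀ : SameBlocksAbove B B₀ ρ
    B~B₀ {X} X∈ = mk⇔ (Equivalence.to (B₁~B₀ X∈) ∘ ⪯-respˡ-span {B} {B₁} {X} span)
                      (⪯-respˡ-span {B₁} {B} {X} (sym (proj₁ span) , sym (proj₂ span)) ∘ Equivalence.from (B₁~B₀ X∈))

    open Merge rank positive total B∉ρ B~B₀ B₁~B₀

  module Adjacent (adjacent : minB B₁ ≡ maxB B₀ + 1) where

    private
      m₀ M₀ m₁ M₁ : ℕ
      m₀ = minB B₀
      M₀ = maxB B₀
      m₁ = minB B₁
      M₁ = maxB B₁

      T : Block → ℕ
      T = targetℕ a (suc n)

      m₁≡1+M₀ : m₁ ≡ suc M₀
      m₁≡1+M₀ = ≡-trans adjacent (ℕ.+-comm M₀ 1)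

      M₀<m₁ : M₀ < m₁
      M₀<m₁ = ℕ.≤-reflexive (sym m₁≡1+M₀)

      m₀≤M₀ : m₀ ≤ M₀
      m₀≤M₀ = minB≤maxB B₀≢[]
      m₁≤M₁ : m₁ ≤ M₁
      m₁≤M₁ = minB≤maxB B₁≢[]

      minB-B : minB B ≡ m₀
      minB-B = ≡-trans (minB-∪ B=B₀∪B₁ B₀≢[] B₁≢[]) (ℕ.m≤n⇒m⊓n≡m (ℕ.≤-trans m₀≤M₀ (ℕ.<⇒≤ M₀<m₁)))

      maxB-B : maxB B ≡ M₁
      maxB-B = ≡-trans (maxB-∪ B=B₀∪B₁ B₀≢[] B₁≢[]) (ℕ.m≤n⇒m⊔n≡n (ℕ.≤-trans (ℕ.<⇒≤ M₀<m₁) m₁≤M₁))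

      B₀⋠B₁ : ¬ B₀ ⪯ B₁
      B₀⋠B₁ (m₁≤m₀ , _) = ℕ.<⇒≱ M₀<m₁ (ℕ.≤-trans m₁≤m₀ m₀≤M₀)

      B₁⋠B₀ : ¬ B₁ ⪯ B₀
      B₁⋠B₀ (_ , M₁≤M₀) = ℕ.<⇒≱ M₀<m₁ (ℕ.≤-trans m₁≤M₁ M₁≤M₀)

      B₀⪯⇒B₁⪯ : ∀ {X} → X ∈ ρ → B₀ ⪯ X → B₁ ⪯ X
      B₀⪯⇒B₁⪯ {X} X∈ (minX≤m₀ , M₀≤maxX) with overlapping⇒nested B₁∈ (ρ⊆ X∈) (B₁#ρ X∈)
        (ℕ.≤-trans (ℕ.≤-reflexive m₁≡1+M₀) (≤⇒<-disjoint (B₀#ρ X∈) (maxB-∈ B₀≢[]) (maxB-∈ (nonempty (ρ⊆ X∈))) M₀≤maxX))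
        (ℕ.≤-trans minX≤m₀ (ℕ.≤-trans m₀≤M₀ (ℕ.≤-trans (ℕ.<⇒≤ M₀<m₁) m₁≤M₁)))
      ... | inj₁ B₁⪯X          = B₁⪯X
      ... | inj₂ (m₁≤minX , _) = ⊥-elim (ℕ.<⇒≱ M₀<m₁ (ℕ.≤-trans m₁≤minX (ℕ.≤-trans minX≤m₀ m₀≤M₀)))

      B₁⪯⇒B₀⪯ : ∀ {X} → X ∈ ρ → B₁ ⪯ X → B₀ ⪯ X
      B₁⪯⇒B₀⪯ {X} X∈ (minX≤m₁ , M₁≤maxX) with overlapping⇒nested B₀∈ (ρ⊆ X∈) (B₀#ρ X∈)
        (ℕ.≤-trans m₀≤M₀ (ℕ.≤-trans (ℕ.<⇒≤ M₀<m₁) (ℕ.≤-trans m₁≤M₁ M₁≤maxX)))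
        (ℕ.≤-pred (ℕ.≤-trans (≤⇒<-disjoint (Disjoint-sym (B₁#ρ X∈)) (minB-∈ (nonempty (ρ⊆ X∈))) (minB-∈ B₁≢[]) minX≤m₁)
                              (ℕ.≤-reflexive m₁≡1+M₀)))
      ... | inj₁ B₀⪯X          = B₀⪯X
      ... | inj₂ (_ , maxX≤M₀) = ⊥-elim (ℕ.<⇒≱ M₀<m₁ (ℕ.≤-trans m₁≤M₁ (ℕ.≤-trans M₁≤maxX maxX≤M₀)))

      B₁~B₀ : SameBlocksAbove B₁ B₀ ρ
      B₁~B₀ X∈ = mk⇔ (B₁⪯⇒B₀⪯ X∈) (B₀⪯⇒B₁⪯ X∈)

      B~B₀ : SameBlocksAbove B B₀ ρ
      B~B₀ X∈ = mk⇔
        (λ (minX≤minB , maxB≤maxX) → subst (_ ≤_) minB-B minX≤minB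
                                   , ℕ.≤-trans (ℕ.≤-trans (ℕ.<⇒≤ M₀<m₁) m₁≤M₁) (subst (_≤ _) maxB-B maxB≤maxX))
        (λ B₀⪯X → subst (_ ≤_) (sym minB-B) (proj₁ B₀⪯X) , subst (_≤ _) (sym maxB-B) (proj₂ (B₀⪯⇒B₁⪯ X∈ B₀⪯X)))

      -- A block below B cannot reach across the gap between M₀ and m₁: it would contain the span of B₀.
      below-B : ∀ {Y} → Y ∈ ρ → (Y ⪯ B) ⇔ (Y ⪯ B₀ ⊎ Y ⪯ B₁)
      below-B {Y} Y∈ = mk⇔ split
        [ (λ (m₀≤minY , maxY≤M₀) → subst (_≤ _) (sym minB-B) m₀≤minY
                                 , subst (_ ≤_) (sym maxB-B) (ℕ.≤-trans maxY≤M₀ (ℕ.≤-trans (ℕ.<⇒≤ M₀<m₁) m₁≤M₁)))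
        , (λ (m₁≤minY , maxY≤M₁) → subst (_≤ _) (sym minB-B) (ℕ.≤-trans (ℕ.≤-trans m₀≤M₀ (ℕ.<⇒≤ M₀<m₁)) m₁≤minY)
                                 , subst (_ ≤_) (sym maxB-B) maxY≤M₁) ]′
        where
        Y≢[] : Y ≢ []
        Y≢[] = nonempty (ρ⊆ Y∈)
        split : Y ⪯ B → Y ⪯ B₀ ⊎ Y ⪯ B₁
        split (minB≤minY , maxY≤maxB) with maxB Y ≤? M₀ | m₁ ≤? minB Y
        ... | yes maxY≤M₀ | _           = inj₁ (subst (_≤ _) minB-B minB≤minY , maxY≤M₀)
        ... | no _        | yes m₁≤minY = inj₂ (m₁≤minY , subst (_ ≤_) maxB-B maxY≤maxB)
        ... | no maxY≰M₀  | no m₁≰minY with overlapping⇒nested (ρ⊆ Y∈) B₀∈ (Disjoint-sym (B₀#ρ Y∈))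
              (ℕ.≤-pred (ℕ.≤-trans (ℕ.≰⇒> m₁≰minY) (ℕ.≤-reflexive m₁≡1+M₀)))
              (ℕ.≤-trans (subst (_≤ _) minB-B minB≤minY) (minB≤maxB Y≢[]))
        ...   | inj₁ (_ , maxY≤M₀)   = ⊥-elim (maxY≰M₀ maxY≤M₀)
        ...   | inj₂ (minY≤m₀ , _)   = ⊥-elim (B₀#ρ Y∈ (minB-∈ B₀≢[] ,
                  subst (_∈ Y) (ℕ.≤-antisym minY≤m₀ (subst (_≤ _) minB-B minB≤minY)) (minB-∈ Y≢[])))

      below-B-exclusive : ∀ {Y} → Y ∈ ρ → ¬ (Y ⪯ B₀ × Y ⪯ B₁)
      below-B-exclusive Y∈ ((_ , maxY≤M₀) , (m₁≤minY , _)) =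
        ℕ.<⇒≱ M₀<m₁ (ℕ.≤-trans m₁≤minY (ℕ.≤-trans (minB≤maxB (nonempty (ρ⊆ Y∈))) maxY≤M₀))

      rank-B₀ : r B₀ +ᶻ below r B₀ ρ ≡ t B₀
      rank-B₀ = begin
        r B₀ +ᶻ below r B₀ ρ                                             ≡⟨ cong (r B₀ +ᶻ_) (ℤ.+-identityˡ _) ⟨
        r B₀ +ᶻ (+ 0 +ᶻ below r B₀ ρ)                                    ≡⟨ cong₂ (λ u w → u +ᶻ (w +ᶻ below r B₀ ρ))
            (ind-yes (B₀ ⪯? B₀) (⪯-refl {B₀})) (ind-no (B₁ ⪯? B₀) B₁⋠B₀) ⟨
        ind (B₀ ⪯? B₀) (r B₀) +ᶻ (ind (B₁ ⪯? B₀) (r B₁) +ᶻ below r B₀ ρ) ≡⟨ IsRank⇒below {a} {suc n} rank B₀∈ ⟩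
        t B₀                                                             ∎
        where open ≡-Reasoning

      rank-B₁ : r B₁ +ᶻ below r B₁ ρ ≡ t B₁
      rank-B₁ = begin
        r B₁ +ᶻ below r B₁ ρ                                             ≡⟨ ℤ.+-identityˡ _ ⟨
        + 0 +ᶻ (r B₁ +ᶻ below r B₁ ρ)                                    ≡⟨ cong₂ (λ u w → u +ᶻ (w +ᶻ below r B₁ ρ))
            (ind-no (B₀ ⪯? B₁) B₀⋠B₁) (ind-yes (B₁ ⪯? B₁) (⪯-refl {B₁})) ⟨
        ind (B₀ ⪯? B₁) (r B₀) +ᶻ (ind (B₁ ⪯? B₁) (r B₁) +ᶻ below r B₁ ρ) ≡⟨ IsRank⇒below {a} {suc n} rank B₁∈ ⟩
        t B₁                                                             ∎
        where open ≡-Reasoning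

      merged-sum : (r B₀ +ᶻ r B₁) +ᶻ below r B ρ ≡ + (T B₀ + T B₁)
      merged-sum = begin
        (r B₀ +ᶻ r B₁) +ᶻ below r B ρ                       ≡⟨ cong ((r B₀ +ᶻ r B₁) +ᶻ_)
                                                                 (below-⊎ r B B₀ B₁ ρ below-B below-B-exclusive) ⟩
        (r B₀ +ᶻ r B₁) +ᶻ (below r B₀ ρ +ᶻ below r B₁ ρ)    ≡⟨ +-interchange (r B₀) (r B₁) _ _ ⟩
        (r B₀ +ᶻ below r B₀ ρ) +ᶻ (r B₁ +ᶻ below r B₁ ρ)    ≡⟨ cong₂ _+ᶻ_ rank-B₀ rank-B₁ ⟩
        + (T B₀ + T B₁)                                     ∎
        where open ≡-Reasoning

      len-B : len B ≡ len B₀ + len B₁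
      len-B = begin
        maxB B ∸ minB B + 1              ≡⟨ cong₂ (λ hi lo → hi ∸ lo + 1) maxB-B minB-B ⟩
        M₁ ∸ m₀ + 1                      ≡⟨ cong (_+ 1) (len-split m₀≤M₀ (ℕ.<-≤-trans M₀<m₁ m₁≤M₁)) ⟩
        len B₀ + (M₁ ∸ suc M₀) + 1       ≡⟨ ℕ.+-assoc (len B₀) _ 1 ⟩
        len B₀ + (M₁ ∸ suc M₀ + 1)       ≡⟨ cong (λ m → len B₀ + (M₁ ∸ m + 1)) m₁≡1+M₀ ⟨
        len B₀ + len B₁                  ∎
        where open ≡-Reasoning

      T-B : T B ≡ ceilDiv (len B₀ * a + len B₁ * a) (suc n)
      T-B = cong (λ l → ceilDiv l (suc n)) (≡-trans (cong (_* a) len-B) (ℕ.*-distribʳ-+ a (len B₀) (len B₁)))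

      open Merge rank positive total B∉ρ B~B₀ B₁~B₀

      parent-⋠B : ∀ {P} → P ∈ ρ → B₀ ⪯ P → ¬ P ⪯ B
      parent-⋠B P∈ (minP≤m₀ , _) (minB≤minP , _) = B₀#ρ P∈ (minB-∈ B₀≢[] ,
        subst (_∈ _) (ℕ.≤-antisym minP≤m₀ (subst (_≤ _) minB-B minB≤minP)) (minB-∈ (nonempty (ρ⊆ P∈))))

      -- Without a block above B₀, both B₀ and B₁ are maximal blocks, and their surplus target
      -- exceeds what the maximal blocks can carry.
      no-parent : T B₀ + T B₁ ≡ suc (T B) → ¬ (∀ {X} → X ∈ ρ → ¬ B₀ ⪯ X)
      no-parent excess none =
        no-excess {n} {a} {T B} {∑ℕ T M′} {len B} {∑ℕ len M′} a<b targets-bound lengths-bound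
          (ceilDiv-lower (len B * a) n)
          (subst₂ _≤_ (∑ℕ-*ʳ len a M′) (∑ℕ-*ʳ T (suc n) M′) (∑ℕ-mono-≤ M′ λ {X} _ → ceilDiv-lower (len X * a) n))
        where
        M′ : List Block
        M′ = filter Maximal? ρ

        maximal-B₀ : Maximal B₀
        maximal-B₀ = (λ _ → ⪯-refl {B₀}) ∷ (⊥-elim ∘ B₀⋠B₁) ∷ All.tabulate (λ X∈ → ⊥-elim ∘ none X∈)

        maximal-B₁ : Maximal B₁
        maximal-B₁ = (⊥-elim ∘ B₁⋠B₀) ∷ (λ _ → ⪯-refl {B₁}) ∷ All.tabulate (λ X∈ → ⊥-elim ∘ none X∈ ∘ B₁⪯⇒B₀⪯ X∈)

        maximal-blocks≡ : maximal-blocks ≡ B₀ ∷ B₁ ∷ M′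
        maximal-blocks≡ = ≡-trans (filter-accept Maximal? maximal-B₀) (cong (B₀ ∷_) (filter-accept Maximal? maximal-B₁))

        targets-bound : suc (T B) + ∑ℕ T M′ ≤ a
        targets-bound = subst (_≤ a) (≡-trans (sym (ℕ.+-assoc (T B₀) (T B₁) _)) (cong (_+ ∑ℕ T M′) excess))
          (ℤ.drop‿+≤+ (subst (_≤ᶻ + a) (≡-trans (cong (∑ t) maximal-blocks≡) (∑-pos T (B₀ ∷ B₁ ∷ M′)))
            (ℤ.≤-trans (∑-target-maximal≤ ncp rank (ℤ.<⇒≤ ∘ All.lookup positive)) (ℤ.≤-reflexive total))))

        lengths-bound : n ≤ len B + ∑ℕ len M′
        lengths-bound = subst (n ≤_) (≡-trans (cong (∑ℕ len) maximal-blocks≡)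
                                       (≡-trans (sym (ℕ.+-assoc (len B₀) (len B₁) _)) (cong (_+ ∑ℕ len M′) (sym len-B))))
                          maximal-blocks-cover

      exact-or-excess : T B₀ + T B₁ ≡ T B ⊎ T B₀ + T B₁ ≡ suc (T B)
      exact-or-excess = Sum.map (λ eq → ≡-trans eq (sym T-B)) (λ eq → ≡-trans eq (cong suc (sym T-B)))
                                (ceilDiv-+ (len B₀ * a) (len B₁ * a) n)

    merged : HasValidRanking a (suc n) (B ∷ ρ)
    merged with exact-or-excess
    ... | inj₁ exact  = merge (≡-trans merged-sum (cong +_ exact))
    ... | inj₂ excess with least (B₀ ⪯?_) (λ {X} → ⪯-refl {X}) (λ {X} {Y} {Z} → ⪯-trans {X} {Y} {Z}) ρ
                             (λ X∈ Y∈ → above-comparable (ρ⊆ X∈) (ρ⊆ Y∈) B₀∈)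
    ...   | inj₁ none                      = ⊥-elim (no-parent excess none)
    ...   | inj₂ (P , P∈ , B₀⪯P , P-least) =
      merge-via-parent ρ-unique (≡-trans merged-sum (cong +_ (≡-trans excess (ℕ.+-comm 1 (T B)))))
        P∈ P-least B₀⪯P (parent-⋠B P∈ B₀⪯P)

lemma3p14 : (a b : ℕ) → 0 < a → a < b → Coprime a b →
    (π π' : List Block) →
    NoncrossingPartition (b ∸ 1) π → HasValidRanking a b π →
    NoncrossingPartition (b ∸ 1) π' →
    (B₀ B₁ B : Block) (rest : List Block) →
    π ↭ (B₀ ∷ B₁ ∷ rest) →
    π' ↭ (B ∷ rest) →
    (∀ x → (x ∈ B) ⇔ ((x ∈ B₀) ⊎ (x ∈ B₁))) →
    (minB B₁ ≡ maxB B₀ + 1) ⊎ (B₀ ≺ B₁) →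
    HasValidRanking a b π'
lemma3p14 a (suc n) _ a<b _ π π′ ncp valid ncp′ B₀ B₁ B rest π↭ π′↭ B=B₀∪B₁ shape
  with HasValidRanking-resp-↭ π↭ valid
... | r , rank , positive , total =
  HasValidRanking-resp-↭ (↭-sym π′↭) ([ Adjacent.merged , nested ∘ proj₁ ]′ shape)
  where
  open Merging a<b (NoncrossingPartition-resp-↭ π↭ ncp) (NoncrossingPartition-resp-↭ π′↭ ncp′)
               B=B₀∪B₁ rank positive total
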